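{- Let $W$ be a real $n\times n$ matrix with $W_{ii}=0$, $b\in\mathbb{R}^n$, and $\sigma\subseteq[n]$ with $s^\sigma_\infty\neq 0$. Then $\sigma$ supports a fixed point if and only if for all $i\in\sigma$ and all $j\notin\sigma$: $\operatorname{sgn}(s^\sigma_i\cdot s^\sigma_\infty)=+$ and $\operatorname{sgn}(s^\sigma_j\cdot s^\sigma_\infty)=-$.
   Context: TLN: $\dot x_i=-x_i+[\sum_{j\ne i}W_{ij}x_j+b_i]_+$. In $\mathbb{R}^{n+1}$ (coordinates $(x_1,\dots,x_n,z)$) define vectors $e_i$ = the $i$-th standard basis vector ($i=1,\dots,n$), $e_\infty=(0,\dots,0,1)$, and $h_i=(W_{i1},\dots,W_{i,i-1},-1,W_{i,i+1},\dots,W_{in},b_i)$. For $\sigma\subseteq[n]$ let $a^\sigma$ be the ordered list of $n$ vectors whose $i$-th entry is $h_i$ if $i\in\sigma$ and $e_i$ if $i\notin\sigma$. Define $s^\sigma_i=\det(a^\sigma,e_i)$ for $i\in\sigma\cup\{\infty\}$ and $s^\sigma_i=\det(a^\sigma,h_i)$ for $i\notin\sigma$ (determinant of the $(n+1)\times(n+1)$ matrix with these rows in this order). Let $l^*_i(x)=\sum_{j\ne i}W_{ij}x_j+b_i$, $L^\sigma=\{x\in\mathbb{R}^n: l^*_i(x)>0 \ (i\in\sigma),\ l^*_i(x)<0\ (i\notin\sigma)\}$, and let $x^\sigma$ be the (unique, as $s^\sigma_\infty\ne0$) point with $-x_i+\sum_{j\neq i}W_{ij}x_j+b_i=0$ for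 $i\in\sigma$ and $x_j=0$ for $j\notin\sigma$. We say $\sigma$ supports a fixed point if $x^\sigma\in L^\sigma$. -}

module Defs where

open import Level using (0ℓ)
open import Data.Nat using (ℕ; zero; suc)
open import Data.Fin using (Fin; zero; suc; punchIn; _≟_)
open import Data.Fin.Subset using (Subset; _∈_; _∉_)
open import Data.Vec using (lookup)
open import Data.Bool using (if_then_else_)
open import Data.Product using (∃; _×_)
open import Relation.Nullary using (¬_; does)
open import Relation.Binary.Structures using (IsStrictTotalOrder)
open import Algebra.Bundles using (CommutativeRing)

-- An ordered field (the theorem is purely algebraic; ℝ is an instance).
record OrderedField : Set₁ where
  field
    commutativeRing : CommutativeRing 0ℓ 0ℓ
  open CommutativeRing commutativeRing public
  infix 4 _<_
  field
    _<_ : Carrier → Carrier → Set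
    <-isStrictTotalOrder : IsStrictTotalOrder _≈_ _<_
    +-mono-< : ∀ {a b} c → a < b → a + c < b + c
    *-pos : ∀ {a b} → 0# < a → 0# < b → 0# < a * b
    0<1 : 0# < 1#
    inverse : ∀ a → ¬ (a ≈ 0#) → ∃ λ c → a * c ≈ 1#

module TLN (F : OrderedField) where
  open OrderedField F hiding (zero)

  sumF : ∀ {n} → (Fin n → Carrier) → Carrier
  sumF {zero} f = 0#
  sumF {suc n} f = f zero + sumF (λ j → f (suc j))

  altSign : ∀ {n} → Fin n → Carrier
  altSign zero = 1#
  altSign (suc j) = - altSign j

  det : ∀ {n} → (Fin n → Fin n → Carrier) → Carrier
  det {zero} M = 1#
  det {suc n} M =
    sumF (λ j → altSign j * (M zero j * det (λ r c → M (suc r) (punchIn j c))))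

  snoc : ∀ {A : Set} {n} → (Fin n → A) → A → Fin (suc n) → A
  snoc {n = zero} v z zero = z
  snoc {n = suc n} v z zero = v zero
  snoc {n = suc n} v z (suc k) = snoc (λ j → v (suc j)) z k

  module _ {n : ℕ} (W : Fin n → Fin n → Carrier) (b : Fin n → Carrier) where

    e : Fin n → Fin (suc n) → Carrier
    e i = snoc (λ k → if does (k ≟ i) then 1# else 0#) 0#

    e∞ : Fin (suc n) → Carrier
    e∞ = snoc (λ _ → 0#) 1#

    h : Fin n → Fin (suc n) → Carrier
    h i = snoc (λ k → if does (k ≟ i) then - 1# else W i k) (b i)

    a : Subset n → Fin n → Fin (suc n) → Carrier
    a σ i = if lookup σ i then h i else e i

    detWith : Subset n → (Fin (suc n) → Carrier) → Carrier
    detWith σ v = det (snoc (a σ) v)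

    s : Subset n → Fin n → Carrier
    s σ i = if lookup σ i then detWith σ (e i) else detWith σ (h i)

    s∞ : Subset n → Carrier
    s∞ σ = detWith σ e∞

    lstar : Fin n → (Fin n → Carrier) → Carrier
    lstar i x = sumF (λ j → if does (j ≟ i) then 0# else W i j * x j) + b i

    L : Subset n → (Fin n → Carrier) → Set
    L σ x = (∀ i → i ∈ σ → 0# < lstar i x) × (∀ i → i ∉ σ → lstar i x < 0#)

    IsXσ : Subset n → (Fin n → Carrier) → Set
    IsXσ σ x = (∀ i → i ∈ σ → (- x i) + lstar i x ≈ 0#) × (∀ j → j ∉ σ → x j ≈ 0#)

    SupportsFP : Subset n → Set
    SupportsFP σ = ∃ λ x → IsXσ σ x × L σ x

module Submission where

-- Write φ(v) = det(a^σ, v), a linear form on ℝ^{n+1}; then s^σ_i is φ(e_i) (i ∈ σ) or φ(h_i)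
-- (i ∉ σ), and s^σ_∞ = φ(e_∞).  A point x is x^σ exactly when y = (x, 1) is orthogonal to every
-- row of a^σ: for r ∈ σ, ⟨h_r, y⟩ = −x_r + l*_r(x), and for r ∉ σ, ⟨e_r, y⟩ = x_r.  By Cramer's
-- rule any such y satisfies y_∞ φ(v) = ⟨v, y⟩ φ(e_∞), so s^σ_i = l*_i(x^σ) s^σ_∞ for every i and
-- s^σ_i s^σ_∞ = l*_i(x^σ) (s^σ_∞)² has the sign of l*_i(x^σ).  When s^σ_∞ ≠ 0, x^σ exists: the
-- cofactor vector (φ(e_1), …, φ(e_n), φ(e_∞)) is orthogonal to every row r, since φ(a^σ_r) has a
-- repeated row.  The determinant is defined by expansion along the first row, so the column
-- operation behind Cramer's rule goes through det Mᵀ = det M.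

open import Defs
open import Data.Nat using (ℕ; zero; suc)
open import Data.Fin using (Fin; zero; suc; punchIn; inject₁; fromℕ; _≟_)
open import Data.Fin.Properties using (punchInᵢ≢i)
open import Data.Fin.Subset using (Subset; _∈_; _∉_)
open import Data.Fin.Subset.Properties using (_∈?_)
open import Data.Vec using (lookup)
open import Data.Vec.Properties using ([]=⇒lookup; lookup⇒[]=)
open import Data.Vec.Functional using (updateAt; init; last)
open import Data.Vec.Functional.Properties using (map-updateAt)
open import Data.Bool using (true; false; if_then_else_)
open import Data.Product using (∃; _×_; _,_; proj₁; proj₂)
open import Data.Empty using (⊥-elim)
open import Function.Base using (_∘_)
open import Function.Bundles using (_⇔_; mk⇔; Equivalence)
open import Relation.Nullary using (¬_; does; yes; no)
open import Relation.Nullary.Decidable using (dec-true; dec-false)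
open import Relation.Binary.Definitions using (tri<; tri≈; tri>)
open import Relation.Binary.PropositionalEquality as ≡ using (_≡_; _≢_)
open import Relation.Binary.Structures using (IsStrictTotalOrder)

init-last-elim : ∀ {n} (P : Fin (suc n) → Set) → (∀ k → P (inject₁ k)) → P (fromℕ n) → ∀ c → P c
init-last-elim {zero} P P-init P-last zero = P-last
init-last-elim {suc n} P P-init P-last zero = P-init zero
init-last-elim {suc n} P P-init P-last (suc c) = init-last-elim (P ∘ suc) (P-init ∘ suc) P-last c

punchIn-inject₁ : ∀ {n} (j : Fin (suc n)) (c : Fin n) → punchIn (inject₁ j) (inject₁ c) ≡ inject₁ (punchIn j c)
punchIn-inject₁ zero c = ≡.refl
punchIn-inject₁ (suc j) zero = ≡.refl
punchIn-inject₁ (suc j) (suc c) = ≡.cong suc (punchIn-inject₁ j c)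

infix 10 _[_]≔_
_[_]≔_ : ∀ {A : Set} {n} → (Fin n → A) → Fin n → A → Fin n → A
xs [ i ]≔ x = updateAt xs i (λ _ → x)

module _ (F : OrderedField) where
  open OrderedField F hiding (zero)
  open TLN F
  open IsStrictTotalOrder <-isStrictTotalOrder using (compare; irrefl; <-respˡ-≈; <-respʳ-≈)
    renaming (trans to <-trans)
  open import Algebra.Properties.Ring ring
    using (-1*x≈-x; -‿distribˡ-*; -‿distribʳ-*; -‿involutive; -0#≈0#; +-inverseʳ-unique)
  open import Algebra.Properties.Semiring.Sum semiring
    using ( sum; sum-cong-≋; sum-cong-≗; sum-replicate-zero; sum-init-last; sum-remove
          ; ∑-comm; ∑-distrib-+; *-distribˡ-sum; *-distribʳ-sum)
  open import Algebra.Solver.Ring.NaturalCoefficients.Default commutativeSemiring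
    using (solve; _:+_; _:*_; _:=_)
  open import Relation.Binary.Reasoning.Setoid setoid

  -- Signs in an ordered field

  a<0⇒0<-a : ∀ {a} → a < 0# → 0# < - a
  a<0⇒0<-a {a} a<0 = <-respʳ-≈ (+-identityˡ (- a)) (<-respˡ-≈ (-‿inverseʳ a) (+-mono-< (- a) a<0))

  0<-a⇒a<0 : ∀ {a} → 0# < - a → a < 0#
  0<-a⇒a<0 {a} 0<-a = <-respʳ-≈ (-‿inverseˡ a) (<-respˡ-≈ (+-identityˡ a) (+-mono-< a 0<-a))

  a<0⇒a*p<0 : ∀ {a p} → a < 0# → 0# < p → a * p < 0#
  a<0⇒a*p<0 {a} {p} a<0 0<p = 0<-a⇒a<0 (<-respʳ-≈ (sym (-‿distribˡ-* a p)) (*-pos (a<0⇒0<-a a<0) 0<p))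

  d≉0⇒0<d*d : ∀ {d} → ¬ (d ≈ 0#) → 0# < d * d
  d≉0⇒0<d*d {d} d≉0 with compare d 0#
  ... | tri< d<0 _ _ = <-respʳ-≈ (-d*-d≈d*d) (*-pos (a<0⇒0<-a d<0) (a<0⇒0<-a d<0))
    where
    -d*-d≈d*d : - d * - d ≈ d * d
    -d*-d≈d*d = begin
      - d * - d      ≈⟨ -‿distribˡ-* d (- d) ⟨
      - (d * - d)    ≈⟨ -‿cong (-‿distribʳ-* d d) ⟨
      - (- (d * d))  ≈⟨ -‿involutive (d * d) ⟩
      d * d          ∎
  ... | tri≈ _ d≈0 _ = ⊥-elim (d≉0 d≈0)
  ... | tri> _ _ 0<d = *-pos 0<d 0<d

  0<a⇔0<a*p : ∀ {a p} → 0# < p → (0# < a ⇔ 0# < a * p)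
  0<a⇔0<a*p {a} {p} 0<p = mk⇔ (λ 0<a → *-pos 0<a 0<p) from
    where
    from : 0# < a * p → 0# < a
    from 0<ap with compare a 0#
    ... | tri< a<0 _ _ = ⊥-elim (irrefl refl (<-trans 0<ap (a<0⇒a*p<0 a<0 0<p)))
    ... | tri≈ _ a≈0 _ = ⊥-elim (irrefl refl (<-respʳ-≈ (trans (*-congʳ a≈0) (zeroˡ p)) 0<ap))
    ... | tri> _ _ 0<a = 0<a

  a<0⇔a*p<0 : ∀ {a p} → 0# < p → (a < 0# ⇔ a * p < 0#)
  a<0⇔a*p<0 {a} {p} 0<p = mk⇔ (λ a<0 → a<0⇒a*p<0 a<0 0<p) from
    where
    from : a * p < 0# → a < 0#
    from ap<0 with compare a 0#
    ... | tri< a<0 _ _ = a<0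
    ... | tri≈ _ a≈0 _ = ⊥-elim (irrefl refl (<-respˡ-≈ (trans (*-congʳ a≈0) (zeroˡ p)) ap<0))
    ... | tri> _ _ 0<a = ⊥-elim (irrefl refl (<-trans (*-pos 0<a 0<p) ap<0))

  -- Finite sums

  sumF≡sum : ∀ {n} (f : Fin n → Carrier) → sumF f ≡ sum f
  sumF≡sum {zero} f = ≡.refl
  sumF≡sum {suc n} f = ≡.cong (f zero +_) (sumF≡sum (f ∘ suc))

  sum-zero : ∀ {n} {f : Fin n → Carrier} → (∀ i → f i ≈ 0#) → sum f ≈ 0#
  sum-zero {n} f≈0 = trans (sum-cong-≋ f≈0) (sum-replicate-zero n)

  sum-linear : ∀ {n} α β (f g : Fin n → Carrier) →
               sum (λ i → α * f i + β * g i) ≈ α * sum f + β * sum g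
  sum-linear α β f g = trans (∑-distrib-+ (λ i → α * f i) (λ i → β * g i))
                             (sym (+-cong (*-distribˡ-sum α f) (*-distribˡ-sum β g)))

  sum-concentrated : ∀ {n} (f : Fin n → Carrier) (i : Fin n) → (∀ k → k ≢ i → f k ≈ 0#) → sum f ≈ f i
  sum-concentrated {suc n} f i f≈0 = begin
    sum f                       ≈⟨ sum-remove {i = i} f ⟩
    f i + sum (f ∘ punchIn i)   ≈⟨ +-congˡ (sum-zero (λ k → f≈0 (punchIn i k) (punchInᵢ≢i i k))) ⟩
    f i + 0#                    ≈⟨ +-identityʳ (f i) ⟩
    f i                         ∎

  if-≟-≡ : ∀ {A : Set} {n} (i : Fin n) {x y : A} → (if does (i ≟ i) then x else y) ≡ x
  if-≟-≡ i {x} {y} = ≡.cong (λ t → if t then x else y) (dec-true (i ≟ i) ≡.refl)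

  if-≟-≢ : ∀ {A : Set} {n} {i j : Fin n} {x y : A} → i ≢ j → (if does (i ≟ j) then x else y) ≡ y
  if-≟-≢ {i = i} {j} {x} {y} i≢j = ≡.cong (λ t → if t then x else y) (dec-false (i ≟ j) i≢j)

  infix 7 _·_
  _·_ : ∀ {n} → (Fin n → Carrier) → (Fin n → Carrier) → Carrier
  u · v = sum (λ c → u c * v c)

  -- Vectors with an appended last entry

  snoc-inject₁ : ∀ {A : Set} {n} (f : Fin n → A) (z : A) (k : Fin n) → snoc f z (inject₁ k) ≡ f k
  snoc-inject₁ f z zero = ≡.refl
  snoc-inject₁ f z (suc k) = snoc-inject₁ (f ∘ suc) z k

  snoc-fromℕ : ∀ {A : Set} {n} (f : Fin n → A) (z : A) → snoc f z (fromℕ n) ≡ z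
  snoc-fromℕ {n = zero} f z = ≡.refl
  snoc-fromℕ {n = suc n} f z = snoc-fromℕ (f ∘ suc) z

  snoc-init-last : ∀ {A : Set} {n} (v : Fin (suc n) → A) (k : Fin (suc n)) → snoc (init v) (last v) k ≡ v k
  snoc-init-last {n = zero} v zero = ≡.refl
  snoc-init-last {n = suc n} v zero = ≡.refl
  snoc-init-last {n = suc n} v (suc k) = snoc-init-last (v ∘ suc) k

  snoc-map : ∀ {A B : Set} {n} (g : A → B) (f : Fin n → A) (z : A) (k : Fin (suc n)) →
             g (snoc f z k) ≡ snoc (g ∘ f) (g z) k
  snoc-map {n = zero} g f z zero = ≡.refl
  snoc-map {n = suc n} g f z zero = ≡.refl
  snoc-map {n = suc n} g f z (suc k) = snoc-map g (f ∘ suc) z k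

  snoc-punchIn-fromℕ : ∀ {A : Set} {n} (f : Fin n → A) (z : A) (c : Fin n) → snoc f z (punchIn (fromℕ n) c) ≡ f c
  snoc-punchIn-fromℕ f z zero = ≡.refl
  snoc-punchIn-fromℕ f z (suc c) = snoc-punchIn-fromℕ (f ∘ suc) z c

  snoc-punchIn-inject₁ : ∀ {A : Set} {n} (f : Fin (suc n) → A) (z : A) (j c : Fin (suc n)) →
                         snoc f z (punchIn (inject₁ j) c) ≡ snoc (f ∘ punchIn j) z c
  snoc-punchIn-inject₁ f z zero c = ≡.refl
  snoc-punchIn-inject₁ {n = suc n} f z (suc j) zero = ≡.refl
  snoc-punchIn-inject₁ {n = suc n} f z (suc j) (suc c) = snoc-punchIn-inject₁ (f ∘ suc) z j c

  snoc-[fromℕ]≔ : ∀ {A : Set} {n} (f : Fin n → A) (z w : A) (k : Fin (suc n)) →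
                  (snoc f z [ fromℕ n ]≔ w) k ≡ snoc f w k
  snoc-[fromℕ]≔ {n = zero} f z w zero = ≡.refl
  snoc-[fromℕ]≔ {n = suc n} f z w zero = ≡.refl
  snoc-[fromℕ]≔ {n = suc n} f z w (suc k) = snoc-[fromℕ]≔ (f ∘ suc) z w k

  snoc-congʳ : ∀ {n m} (f : Fin n → Fin m → Carrier) {w w′ : Fin m → Carrier} →
               (∀ c → w c ≈ w′ c) → ∀ r c → snoc f w r c ≈ snoc f w′ r c
  snoc-congʳ f {w} {w′} w≈w′ = init-last-elim _
    (λ k c → reflexive (≡.trans (≡.cong-app (snoc-inject₁ f w k) c)
                                (≡.sym (≡.cong-app (snoc-inject₁ f w′ k) c))))
    (λ c → trans (reflexive (≡.cong-app (snoc-fromℕ f w) c))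
                 (trans (w≈w′ c) (reflexive (≡.sym (≡.cong-app (snoc-fromℕ f w′) c)))))

  altSign-inject₁ : ∀ {n} (j : Fin n) → altSign (inject₁ j) ≡ altSign j
  altSign-inject₁ zero = ≡.refl
  altSign-inject₁ (suc j) = ≡.cong -_ (altSign-inject₁ j)

  δ : ∀ {n} → Fin n → Fin n → Carrier
  δ i k = if does (k ≟ i) then 1# else 0#

  -- These are e W b i and e∞ W b, which do not depend on W and b.
  unit : ∀ {n} → Fin n → Fin (suc n) → Carrier
  unit i = snoc (δ i) 0#

  unitLast : ∀ {n} → Fin (suc n) → Carrier
  unitLast = snoc (λ _ → 0#) 1#

  dot-snoc : ∀ {n} (u : Fin (suc n) → Carrier) (x : Fin n → Carrier) (t : Carrier) →
             u · snoc x t ≈ sum (λ k → init u k * x k) + last u * t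
  dot-snoc {n} u x t = begin
    u · snoc x t
      ≈⟨ sum-init-last (λ c → u c * snoc x t c) ⟩
    sum (λ k → init u k * snoc x t (inject₁ k)) + last u * snoc x t (fromℕ n)
      ≈⟨ +-cong (sum-cong-≋ (λ k → *-congˡ (reflexive (snoc-inject₁ x t k)))) (*-congˡ (reflexive (snoc-fromℕ x t))) ⟩
    sum (λ k → init u k * x k) + last u * t
      ∎

  unit-expansion : ∀ {n} (v : Fin (suc n) → Carrier) c → v c ≈ sum (λ k → init v k * unit k c) + last v * unitLast c
  unit-expansion {n} v = init-last-elim _ at-init at-last
    where
    zeros : Fin n → Carrier
    zeros _ = 0#
    at-init : ∀ c → v (inject₁ c) ≈ sum (λ k → init v k * unit k (inject₁ c)) + last v * unitLast (inject₁ c)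
    at-init c = sym (begin
      sum (λ k → init v k * unit k (inject₁ c)) + last v * unitLast (inject₁ c)
        ≈⟨ +-cong (sum-cong-≋ (λ k → *-congˡ (reflexive (snoc-inject₁ (δ k) 0# c))))
                  (*-congˡ (reflexive (snoc-inject₁ zeros 1# c))) ⟩
      sum (λ k → init v k * δ k c) + last v * 0#
        ≈⟨ +-cong (sum-concentrated _ c (λ k k≢c → trans (*-congˡ (reflexive (if-≟-≢ (k≢c ∘ ≡.sym)))) (zeroʳ _)))
                  (zeroʳ _) ⟩
      init v c * δ c c + 0#
        ≈⟨ +-identityʳ _ ⟩
      init v c * δ c c
        ≈⟨ trans (*-congˡ (reflexive (if-≟-≡ c))) (*-identityʳ _) ⟩
      v (inject₁ c)
        ∎)
    at-last : v (fromℕ n) ≈ sum (λ k → init v k * unit k (fromℕ n)) + last v * unitLast (fromℕ n)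
    at-last = sym (begin
      sum (λ k → init v k * unit k (fromℕ n)) + last v * unitLast (fromℕ n)
        ≈⟨ +-cong (sum-zero (λ k → trans (*-congˡ {init v k} (reflexive (snoc-fromℕ (δ k) 0#))) (zeroʳ _)))
                  (*-congˡ (reflexive (snoc-fromℕ zeros 1#))) ⟩
      0# + last v * 1#
        ≈⟨ trans (+-identityˡ _) (*-identityʳ _) ⟩
      v (fromℕ n)
        ∎)

  -- Determinants

  Matrix : ℕ → Set
  Matrix n = Fin n → Fin n → Carrier

  minor : ∀ {n} → Matrix (suc n) → Fin (suc n) → Matrix n
  minor M j r c = M (suc r) (punchIn j c)

  det-expand : ∀ {n} (M : Matrix (suc n)) → det M ≡ sum (λ j → altSign j * (M zero j * det (minor M j)))
  det-expand M = sumF≡sum (λ j → altSign j * (M zero j * det (minor M j)))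

  det-cong : ∀ {n} {M N : Matrix n} → (∀ r c → M r c ≈ N r c) → det M ≈ det N
  det-cong {zero} M≈N = refl
  det-cong {suc n} {M} {N} M≈N = begin
    det M
      ≡⟨ det-expand M ⟩
    sum (λ j → altSign j * (M zero j * det (minor M j)))
      ≈⟨ sum-cong-≋ (λ j → *-congˡ {altSign j} (*-cong (M≈N zero j) (det-cong (λ r c → M≈N (suc r) (punchIn j c))))) ⟩
    sum (λ j → altSign j * (N zero j * det (minor N j)))
      ≡⟨ det-expand N ⟨
    det N
      ∎

  minor-[suc]≔ : ∀ {n} (M : Matrix (suc n)) (r : Fin n) (w : Fin (suc n) → Carrier) (j : Fin (suc n)) →
                 ∀ r′ c → minor (M [ suc r ]≔ w) j r′ c ≡ (minor M j [ r ]≔ (w ∘ punchIn j)) r′ c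
  minor-[suc]≔ M r w j r′ = ≡.cong-app (map-updateAt {f = _∘ punchIn j} (λ _ → ≡.refl) (M ∘ suc) r r′)

  det-linear : ∀ {n} (M : Matrix n) (r : Fin n) {α β : Carrier} {u v w : Fin n → Carrier} →
               (∀ c → w c ≈ α * u c + β * v c) →
               det (M [ r ]≔ w) ≈ α * det (M [ r ]≔ u) + β * det (M [ r ]≔ v)
  det-linear {suc n} M zero {α} {β} {u} {v} {w} w≈ = begin
    det (M [ zero ]≔ w)                                 ≡⟨ det-expand (M [ zero ]≔ w) ⟩
    sum (λ j → altSign j * (w j * det (minor M j)))     ≈⟨ sum-cong-≋ split ⟩
    sum (λ j → α * term u j + β * term v j)             ≈⟨ sum-linear α β (term u) (term v) ⟩
    α * sum (term u) + β * sum (term v)                 ≡⟨ ≡.cong₂ (λ p q → α * p + β * q)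
                                                                   (det-expand (M [ zero ]≔ u)) (det-expand (M [ zero ]≔ v)) ⟨
    α * det (M [ zero ]≔ u) + β * det (M [ zero ]≔ v)   ∎
    where
    term : (Fin (suc n) → Carrier) → Fin (suc n) → Carrier
    term x j = altSign j * (x j * det (minor M j))
    split : ∀ j → altSign j * (w j * det (minor M j)) ≈ α * term u j + β * term v j
    split j = trans (*-congˡ (*-congʳ (w≈ j)))
      (solve 6 (λ s a b x y d → s :* ((a :* x :+ b :* y) :* d) := a :* (s :* (x :* d)) :+ b :* (s :* (y :* d))) refl
        (altSign j) α β (u j) (v j) (det (minor M j)))
  det-linear {suc n} M (suc r) {α} {β} {u} {v} {w} w≈ = begin
    det (M [ suc r ]≔ w)                                                       ≡⟨ det-expand (M [ suc r ]≔ w) ⟩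
    sum (λ j → altSign j * (M zero j * det (minor (M [ suc r ]≔ w) j)))        ≈⟨ sum-cong-≋ split ⟩
    sum (λ j → α * term u j + β * term v j)                                    ≈⟨ sum-linear α β (term u) (term v) ⟩
    α * sum (term u) + β * sum (term v)                                        ≡⟨ ≡.cong₂ (λ p q → α * p + β * q)
                                     (det-expand (M [ suc r ]≔ u)) (det-expand (M [ suc r ]≔ v)) ⟨
    α * det (M [ suc r ]≔ u) + β * det (M [ suc r ]≔ v)                        ∎
    where
    term : (Fin (suc n) → Carrier) → Fin (suc n) → Carrier
    term x j = altSign j * (M zero j * det (minor (M [ suc r ]≔ x) j))
    minor-det : ∀ x j → det (minor (M [ suc r ]≔ x) j) ≈ det (minor M j [ r ]≔ (x ∘ punchIn j))
    minor-det x j = det-cong (λ r′ c → reflexive (minor-[suc]≔ M r x j r′ c))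
    split : ∀ j → altSign j * (M zero j * det (minor (M [ suc r ]≔ w) j)) ≈ α * term u j + β * term v j
    split j = begin
      altSign j * (M zero j * det (minor (M [ suc r ]≔ w) j))
        ≈⟨ *-congˡ (*-congˡ (trans (minor-det w j) (det-linear (minor M j) r (w≈ ∘ punchIn j)))) ⟩
      altSign j * (M zero j * (α * det (minor M j [ r ]≔ (u ∘ punchIn j)) + β * det (minor M j [ r ]≔ (v ∘ punchIn j))))
        ≈⟨ *-congˡ (*-congˡ (+-cong (*-congˡ (minor-det u j)) (*-congˡ (minor-det v j))) ) ⟨
      altSign j * (M zero j * (α * det (minor (M [ suc r ]≔ u) j) + β * det (minor (M [ suc r ]≔ v) j)))
        ≈⟨ solve 6 (λ s m a b x y → s :* (m :* (a :* x :+ b :* y)) := a :* (s :* (m :* x)) :+ b :* (s :* (m :* y))) refl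
             (altSign j) (M zero j) α β (det (minor (M [ suc r ]≔ u) j)) (det (minor (M [ suc r ]≔ v) j)) ⟩
      α * term u j + β * term v j
        ∎

  *-*-distribˡ-sum : ∀ {n} x y (f : Fin n → Carrier) → x * (y * sum f) ≈ sum (λ i → x * (y * f i))
  *-*-distribˡ-sum x y f = trans (*-congˡ (*-distribˡ-sum y f)) (*-distribˡ-sum x (λ i → y * f i))

  -x*[y*[z*[w*d]]]≈-z*[w*[x*[y*d]]] : ∀ x y z w d → - x * (y * (z * (w * d))) ≈ - z * (w * (x * (y * d)))
  -x*[y*[z*[w*d]]]≈-z*[w*[x*[y*d]]] x y z w d = begin
    - x * (y * (z * (w * d)))    ≈⟨ -‿distribˡ-* x _ ⟨
    - (x * (y * (z * (w * d))))  ≈⟨ -‿cong (solve 5 (λ x y z w d → x :* (y :* (z :* (w :* d))) := z :* (w :* (x :* (y :* d))))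
                                                     refl x y z w d) ⟩
    - (z * (w * (x * (y * d))))  ≈⟨ -‿distribˡ-* z _ ⟩
    - z * (w * (x * (y * d)))    ∎

  -- Both sides expand to the same double sum, indexed by the entries M 0 (j+1), M (i+1) 0 and the
  -- minor without rows 0, i+1 and columns 0, j+1.
  det-expand-column : ∀ {n} (M : Matrix (suc n)) →
                      det M ≈ sum (λ i → altSign i * (M i zero * det (λ r c → M (punchIn i r) (suc c))))
  det-expand-column {zero} M = refl
  det-expand-column {suc n} M = begin
    det M
      ≡⟨ det-expand M ⟩
    t₀ + sum (λ j → - altSign j * (M zero (suc j) * det (minor M (suc j))))
      ≈⟨ +-congˡ (sum-cong-≋ (λ j → *-congˡ { - altSign j} (*-congˡ {M zero (suc j)}
                                       (det-expand-column (minor M (suc j)))))) ⟩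
    t₀ + sum (λ j → - altSign j * (M zero (suc j) * sum (λ i → altSign i * (M (suc i) zero * D i j))))
      ≈⟨ +-congˡ (sum-cong-≋ (λ j → *-*-distribˡ-sum (- altSign j) (M zero (suc j))
                                       (λ i → altSign i * (M (suc i) zero * D i j)))) ⟩
    t₀ + sum (λ j → sum (λ i → - altSign j * (M zero (suc j) * (altSign i * (M (suc i) zero * D i j)))))
      ≈⟨ +-congˡ (∑-comm (λ j i → - altSign j * (M zero (suc j) * (altSign i * (M (suc i) zero * D i j))))) ⟩
    t₀ + sum (λ i → sum (λ j → - altSign j * (M zero (suc j) * (altSign i * (M (suc i) zero * D i j)))))
      ≈⟨ +-congˡ (sum-cong-≋ (λ i → sum-cong-≋ (λ j →
           -x*[y*[z*[w*d]]]≈-z*[w*[x*[y*d]]] (altSign j) (M zero (suc j)) (altSign i) (M (suc i) zero) (D i j)))) ⟩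
    t₀ + sum (λ i → sum (λ j → - altSign i * (M (suc i) zero * (altSign j * (M zero (suc j) * D i j)))))
      ≈⟨ +-congˡ (sum-cong-≋ (λ i → *-*-distribˡ-sum (- altSign i) (M (suc i) zero)
                                       (λ j → altSign j * (M zero (suc j) * D i j)))) ⟨
    t₀ + sum (λ i → - altSign i * (M (suc i) zero * sum (λ j → altSign j * (M zero (suc j) * D i j))))
      ≡⟨ ≡.cong (t₀ +_) (sum-cong-≗ (λ i → ≡.cong (λ t → - altSign i * (M (suc i) zero * t))
                                                 (det-expand (λ r c → M (punchIn (suc i) r) (suc c))))) ⟨
    t₀ + sum (λ i → - altSign i * (M (suc i) zero * det (λ r c → M (punchIn (suc i) r) (suc c))))
      ∎
    where
    t₀ : Carrier
    t₀ = 1# * (M zero zero * det (minor M zero))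
    D : Fin (suc n) → Fin (suc n) → Carrier
    D i j = det (λ r c → M (suc (punchIn i r)) (suc (punchIn j c)))

  det-transpose : ∀ {n} (M : Matrix n) → det (λ r c → M c r) ≈ det M
  det-transpose {zero} M = refl
  det-transpose {suc n} M = begin
    det (λ r c → M c r)
      ≡⟨ det-expand (λ r c → M c r) ⟩
    sum (λ j → altSign j * (M j zero * det (λ r c → M (punchIn j c) (suc r))))
      ≈⟨ sum-cong-≋ (λ j → *-congˡ {altSign j} (*-congˡ {M j zero} (det-transpose (λ r c → M (punchIn j r) (suc c))))) ⟩
    sum (λ j → altSign j * (M j zero * det (λ r c → M (punchIn j r) (suc c))))
      ≈⟨ det-expand-column M ⟨
    det M
      ∎

  det-rows01-equal : ∀ {n} (M : Matrix (suc (suc n))) → (∀ c → M zero c ≈ M (suc zero) c) → det M ≈ 0#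
  det-rows01-equal {n} M M₀≈M₁ = begin
    det M
      ≈⟨ det-expand-column M ⟩
    1# * (M zero zero * det M₀) + (- 1# * (M (suc zero) zero * det M₁) + sum rest)
      ≈⟨ +-congˡ (+-cong (*-congˡ (*-cong (sym (M₀≈M₁ zero)) (det-cong M₁≈M₀))) (sum-zero rest≈0)) ⟩
    1# * (M zero zero * det M₀) + (- 1# * (M zero zero * det M₀) + 0#)
      ≈⟨ +-congˡ (+-identityʳ _) ⟩
    1# * t + - 1# * t
      ≈⟨ distribʳ t 1# (- 1#) ⟨
    (1# + - 1#) * t
      ≈⟨ *-congʳ (-‿inverseʳ 1#) ⟩
    0# * t
      ≈⟨ zeroˡ t ⟩
    0#
      ∎
    where
    M₀ M₁ : Matrix (suc n)
    M₀ r c = M (suc r) (suc c)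
    M₁ r c = M (punchIn (suc zero) r) (suc c)
    t : Carrier
    t = M zero zero * det M₀
    M₁≈M₀ : ∀ r c → M₁ r c ≈ M₀ r c
    M₁≈M₀ zero c = M₀≈M₁ (suc c)
    M₁≈M₀ (suc r) c = refl
    Mᵢ : Fin n → Matrix (suc n)
    Mᵢ i r c = M (punchIn (suc (suc i)) r) (suc c)
    rest : Fin n → Carrier
    rest i = altSign (suc (suc i)) * (M (suc (suc i)) zero * det (Mᵢ i))
    -- Matching on i exposes n = suc _, which the recursive call needs.
    minor-vanishes : ∀ i → det (Mᵢ i) ≈ 0#
    minor-vanishes i@zero = det-rows01-equal (Mᵢ i) (M₀≈M₁ ∘ suc)
    minor-vanishes i@(suc _) = det-rows01-equal (Mᵢ i) (M₀≈M₁ ∘ suc)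
    rest≈0 : ∀ i → rest i ≈ 0#
    rest≈0 i = trans (*-congˡ (*-congˡ (minor-vanishes i))) (trans (*-congˡ (zeroʳ _)) (zeroʳ _))

  swap01 : ∀ {n} → Fin (suc (suc n)) → Fin (suc (suc n))
  swap01 zero = suc zero
  swap01 (suc zero) = zero
  swap01 (suc (suc k)) = suc (suc k)

  det-swap01 : ∀ {n} (M : Matrix (suc (suc n))) → det (M ∘ swap01) ≈ - det M
  det-swap01 {n} M = +-inverseʳ-unique (det M) (det (M ∘ swap01)) (begin
    det M + det (M ∘ swap01)
      ≈⟨ +-cong (det-cong {M = M} {N = B u v} (λ { zero c → refl ; (suc zero) c → refl ; (suc (suc k)) c → refl }))
                (det-cong {M = M ∘ swap01} {N = B v u} (λ { zero c → refl ; (suc zero) c → refl ; (suc (suc k)) c → refl })) ⟩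
    det (B u v) + det (B v u)
      ≈⟨ +-cong (+-identityˡ _) (+-identityʳ _) ⟨
    (0# + det (B u v)) + (det (B v u) + 0#)
      ≈⟨ +-cong (+-congʳ (det-rows01-equal (B u u) (λ _ → refl))) (+-congˡ (det-rows01-equal (B v v) (λ _ → refl))) ⟨
    (det (B u u) + det (B u v)) + (det (B v u) + det (B v v))
      ≈⟨ +-cong (additive₁ u) (additive₁ v) ⟨
    det (B u w) + det (B v w)
      ≈⟨ additive (M [ suc zero ]≔ w) zero ⟨
    det (B w w)
      ≈⟨ det-rows01-equal (B w w) (λ _ → refl) ⟩
    0#
      ∎)
    where
    u v w : Fin (suc (suc n)) → Carrier
    u = M zero
    v = M (suc zero)
    w c = u c + v c
    B C : (x y : Fin (suc (suc n)) → Carrier) → Matrix (suc (suc n))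
    B x y = (M [ suc zero ]≔ y) [ zero ]≔ x
    C x y = (M [ zero ]≔ x) [ suc zero ]≔ y
    additive : ∀ (N : Matrix (suc (suc n))) r → det (N [ r ]≔ w) ≈ det (N [ r ]≔ u) + det (N [ r ]≔ v)
    additive N r = trans (det-linear N r (λ c → sym (+-cong (*-identityˡ (u c)) (*-identityˡ (v c)))))
                         (+-cong (*-identityˡ _) (*-identityˡ _))
    C≈B : ∀ x y → det (C x y) ≈ det (B x y)
    C≈B x y = det-cong {M = C x y} {N = B x y} (λ { zero c → refl ; (suc zero) c → refl ; (suc (suc k)) c → refl })
    additive₁ : ∀ x → det (B x w) ≈ det (B x u) + det (B x v)
    additive₁ x = trans (sym (C≈B x w)) (trans (additive (M [ zero ]≔ x) (suc zero)) (+-cong (C≈B x u) (C≈B x v)))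

  minor-snoc : ∀ {n} (R : Fin (suc n) → Fin (suc (suc n)) → Carrier) (v : Fin (suc (suc n)) → Carrier) j r c →
               minor (snoc R v) j r c ≡ snoc (λ k → R (suc k) ∘ punchIn j) (v ∘ punchIn j) r c
  minor-snoc R v j r = ≡.cong-app (snoc-map (_∘ punchIn j) (R ∘ suc) v r)

  det-snoc-repeated : ∀ {n} (R : Fin n → Fin (suc n) → Carrier) (r : Fin n) → det (snoc R (R r)) ≈ 0#
  det-snoc-repeated-suc : ∀ {n} (R : Fin (suc n) → Fin (suc (suc n)) → Carrier) (r : Fin n) →
                          det (snoc R (R (suc r))) ≈ 0#

  det-snoc-repeated {suc zero} R zero = det-rows01-equal (snoc R (R zero)) (λ _ → refl)
  -- Swapping the first two rows moves the repeated row R zero to position 1.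
  det-snoc-repeated {suc (suc n)} R zero = begin
    det (snoc R (R zero))    ≈⟨ det-cong {M = snoc R (R zero)} {N = N ∘ swap01}
                                  (λ { zero c → refl ; (suc zero) c → refl ; (suc (suc k)) c → refl }) ⟩
    det (N ∘ swap01)         ≈⟨ det-swap01 N ⟩
    - det N                  ≈⟨ -‿cong (det-snoc-repeated-suc (R ∘ swap01) zero) ⟩
    - 0#                     ≈⟨ -0#≈0# ⟩
    0#                       ∎
    where
    N : Matrix (suc (suc (suc n)))
    N = snoc (R ∘ swap01) (R zero)
  det-snoc-repeated {suc n} R (suc r) = det-snoc-repeated-suc R r

  det-snoc-repeated-suc R r = begin
    det (snoc R (R (suc r)))                                                ≡⟨ det-expand (snoc R (R (suc r))) ⟩
    sum (λ j → altSign j * (R zero j * det (minor (snoc R (R (suc r))) j)))  ≈⟨ sum-zero term≈0 ⟩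
    0#                                                                      ∎
    where
    term≈0 : ∀ j → altSign j * (R zero j * det (minor (snoc R (R (suc r))) j)) ≈ 0#
    term≈0 j = begin
      altSign j * (R zero j * det (minor (snoc R (R (suc r))) j))
        ≈⟨ *-congˡ (*-congˡ (det-cong (λ r′ c → reflexive (minor-snoc R (R (suc r)) j r′ c)))) ⟩
      altSign j * (R zero j * det (snoc (λ k → R (suc k) ∘ punchIn j) (R (suc r) ∘ punchIn j)))
        ≈⟨ *-congˡ (*-congˡ (det-snoc-repeated (λ k → R (suc k) ∘ punchIn j) r)) ⟩
      altSign j * (R zero j * 0#)
        ≈⟨ trans (*-congˡ (zeroʳ _)) (zeroʳ _) ⟩
      0#
        ∎

  det-snoc-congʳ : ∀ {n} (R : Fin n → Fin (suc n) → Carrier) {w w′ : Fin (suc n) → Carrier} →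
                   (∀ c → w c ≈ w′ c) → det (snoc R w) ≈ det (snoc R w′)
  det-snoc-congʳ R {w} {w′} w≈w′ = det-cong {M = snoc R w} {N = snoc R w′} (snoc-congʳ R w≈w′)

  det-snoc-linear : ∀ {n} (R : Fin n → Fin (suc n) → Carrier) {α β : Carrier} {u v w : Fin (suc n) → Carrier} →
                    (∀ c → w c ≈ α * u c + β * v c) →
                    det (snoc R w) ≈ α * det (snoc R u) + β * det (snoc R v)
  det-snoc-linear {n} R {α} {β} {u} {v} {w} w≈ = begin
    det (snoc R w)
      ≈⟨ last-row w ⟨
    det (snoc R u [ fromℕ n ]≔ w)
      ≈⟨ det-linear (snoc R u) (fromℕ n) w≈ ⟩
    α * det (snoc R u [ fromℕ n ]≔ u) + β * det (snoc R u [ fromℕ n ]≔ v)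
      ≈⟨ +-cong (*-congˡ (last-row u)) (*-congˡ (last-row v)) ⟩
    α * det (snoc R u) + β * det (snoc R v)
      ∎
    where
    last-row : ∀ x → det (snoc R u [ fromℕ n ]≔ x) ≈ det (snoc R x)
    last-row x = det-cong {M = snoc R u [ fromℕ n ]≔ x} {N = snoc R x}
                   (λ r c → reflexive (≡.cong-app (snoc-[fromℕ]≔ R u x r) c))

  det-snoc-zero : ∀ {n} (R : Fin n → Fin (suc n) → Carrier) {w : Fin (suc n) → Carrier} →
                  (∀ c → w c ≈ 0#) → det (snoc R w) ≈ 0#
  det-snoc-zero R {w} w≈0 = begin
    det (snoc R w)
      ≈⟨ det-snoc-linear R {0#} {0#} {w} {w} (λ c → trans (w≈0 c) (sym (0*x+0*y≈0 (w c) (w c)))) ⟩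
    0# * det (snoc R w) + 0# * det (snoc R w)
      ≈⟨ 0*x+0*y≈0 _ _ ⟩
    0#
      ∎
    where
    0*x+0*y≈0 : ∀ x y → 0# * x + 0# * y ≈ 0#
    0*x+0*y≈0 x y = trans (+-cong (zeroˡ x) (zeroˡ y)) (+-identityʳ 0#)

  det-snoc-sum : ∀ {n k} (R : Fin n → Fin (suc n) → Carrier) (y : Fin k → Carrier) (U : Fin k → Fin (suc n) → Carrier) →
                 det (snoc R (λ c → sum (λ m → y m * U m c))) ≈ sum (λ m → y m * det (snoc R (U m)))
  det-snoc-sum {k = zero} R y U = det-snoc-zero R (λ _ → refl)
  det-snoc-sum {n} {suc k} R y U = begin
    det (snoc R (λ c → y zero * U zero c + rest c))
      ≈⟨ det-snoc-linear R (λ c → +-congˡ (sym (*-identityˡ (rest c)))) ⟩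
    y zero * det (snoc R (U zero)) + 1# * det (snoc R rest)
      ≈⟨ +-congˡ (trans (*-identityˡ _) (det-snoc-sum R (y ∘ suc) (U ∘ suc))) ⟩
    y zero * det (snoc R (U zero)) + sum (λ m → y (suc m) * det (snoc R (U (suc m))))
      ∎
    where
    rest : Fin (suc n) → Carrier
    rest c = sum (λ m → y (suc m) * U (suc m) c)

  det-snoc-unitLast : ∀ {n} (R : Fin n → Fin (suc n) → Carrier) → det (snoc R unitLast) ≈ det (λ r c → R r (inject₁ c))
  det-snoc-unitLast {zero} R = trans (+-identityʳ _) (trans (*-identityˡ _) (*-identityˡ _))
  det-snoc-unitLast {suc n} R = begin
    det (snoc R unitLast)
      ≡⟨ det-expand (snoc R unitLast) ⟩
    sum term
      ≈⟨ sum-init-last term ⟩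
    sum (init term) + last term
      ≈⟨ +-cong (sum-cong-≋ init-term) last-term≈0 ⟩
    sum (λ j → altSign j * (T zero j * det (minor T j))) + 0#
      ≈⟨ +-identityʳ _ ⟩
    sum (λ j → altSign j * (T zero j * det (minor T j)))
      ≡⟨ det-expand T ⟨
    det T
      ∎
    where
    T : Matrix (suc n)
    T r c = R r (inject₁ c)
    R′ : Fin (suc (suc n)) → Fin n → Fin (suc n) → Carrier
    R′ j k = R (suc k) ∘ punchIn j
    term : Fin (suc (suc n)) → Carrier
    term j = altSign j * (R zero j * det (minor (snoc R unitLast) j))
    minor-det : ∀ j → det (minor (snoc R unitLast) j) ≈ det (snoc (R′ j) (unitLast ∘ punchIn j))
    minor-det j = det-cong (λ r c → reflexive (minor-snoc R unitLast j r c))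
    init-term : ∀ j → term (inject₁ j) ≈ altSign j * (T zero j * det (minor T j))
    init-term j = *-cong (reflexive (altSign-inject₁ j)) (*-congˡ (begin
      det (minor (snoc R unitLast) (inject₁ j))
        ≈⟨ minor-det (inject₁ j) ⟩
      det (snoc (R′ (inject₁ j)) (unitLast ∘ punchIn (inject₁ j)))
        ≈⟨ det-snoc-congʳ (R′ (inject₁ j)) (λ c → reflexive (snoc-punchIn-inject₁ (λ _ → 0#) 1# j c)) ⟩
      det (snoc (R′ (inject₁ j)) unitLast)
        ≈⟨ det-snoc-unitLast (R′ (inject₁ j)) ⟩
      det (λ r c → R (suc r) (punchIn (inject₁ j) (inject₁ c)))
        ≈⟨ det-cong (λ r c → reflexive (≡.cong (R (suc r)) (punchIn-inject₁ j c))) ⟩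
      det (minor T j)
        ∎))
    last-term≈0 : last term ≈ 0#
    last-term≈0 = trans (*-congˡ (*-congˡ (trans (minor-det (fromℕ (suc n)))
                    (det-snoc-zero (R′ (fromℕ (suc n))) (λ c → reflexive (snoc-punchIn-fromℕ (λ _ → 0#) 1# c))))))
                  (trans (*-congˡ (zeroʳ _)) (zeroʳ _))

  det-snoc-combination : ∀ {n} (N : Matrix (suc n)) (y : Fin (suc n) → Carrier) →
                         det (snoc (init N) (λ c → sum (λ m → y m * N m c))) ≈ last y * det N
  det-snoc-combination N y = begin
    det (snoc (init N) (λ c → sum (λ m → y m * N m c)))
      ≈⟨ det-snoc-sum (init N) y N ⟩
    sum (λ m → y m * det (snoc (init N) (N m)))
      ≈⟨ sum-init-last (λ m → y m * det (snoc (init N) (N m))) ⟩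
    sum (λ k → init y k * det (snoc (init N) (init N k))) + last y * det (snoc (init N) (last N))
      ≈⟨ +-cong (sum-zero (λ k → trans (*-congˡ (det-snoc-repeated (init N) k)) (zeroʳ _)))
                (*-congˡ (det-cong {M = snoc (init N) (last N)} {N = N} (λ r c → reflexive (≡.cong-app (snoc-init-last N r) c)))) ⟩
    0# + last y * det N
      ≈⟨ +-identityˡ _ ⟩
    last y * det N
      ∎

  module Cramer {n} (R : Fin n → Fin (suc n) → Carrier) where

    det-snoc-expand : ∀ v → det (snoc R v) ≈ sum (λ k → init v k * det (snoc R (unit k))) + last v * det (snoc R unitLast)
    det-snoc-expand v = begin
      det (snoc R v)
        ≈⟨ det-snoc-linear R (λ c → trans (unit-expansion v c) (+-congʳ (sym (*-identityˡ _)))) ⟩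
      1# * det (snoc R (λ c → sum (λ k → init v k * unit k c))) + last v * det (snoc R unitLast)
        ≈⟨ +-congʳ (trans (*-identityˡ _) (det-snoc-sum R (init v) unit)) ⟩
      sum (λ k → init v k * det (snoc R (unit k))) + last v * det (snoc R unitLast)
        ∎

    cofactors-in-kernel : ∀ {d} → det (snoc R unitLast) * d ≈ 1# →
                          ∀ r → R r · snoc (λ k → det (snoc R (unit k)) * d) 1# ≈ 0#
    cofactors-in-kernel {d} Dd≈1 r = begin
      R r · snoc (λ k → C k * d) 1#
        ≈⟨ dot-snoc (R r) (λ k → C k * d) 1# ⟩
      sum (λ k → init (R r) k * (C k * d)) + last (R r) * 1#
        ≈⟨ +-cong (sum-cong-≋ (λ k → *-assoc (init (R r) k) (C k) d)) (*-congˡ Dd≈1) ⟨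
      sum (λ k → (init (R r) k * C k) * d) + last (R r) * (D * d)
        ≈⟨ +-cong (*-distribʳ-sum d (λ k → init (R r) k * C k)) (*-assoc _ _ _) ⟨
      sum (λ k → init (R r) k * C k) * d + (last (R r) * D) * d
        ≈⟨ distribʳ d _ _ ⟨
      (sum (λ k → init (R r) k * C k) + last (R r) * D) * d
        ≈⟨ *-congʳ (det-snoc-expand (R r)) ⟨
      det (snoc R (R r)) * d
        ≈⟨ *-congʳ (det-snoc-repeated R r) ⟩
      0# * d
        ≈⟨ zeroˡ d ⟩
      0#
        ∎
      where
      C : Fin n → Carrier
      C k = det (snoc R (unit k))
      D : Carrier
      D = det (snoc R unitLast)

    -- On the transpose, replacing the last row by Σ_m y_m · row m scales det by last y and, as
    -- R y = 0, produces the row (v · y) e∞.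
    det-snoc-kernel : ∀ {y} → (∀ r → R r · y ≈ 0#) →
                      ∀ v → last y * det (snoc R v) ≈ (v · y) * det (snoc R unitLast)
    det-snoc-kernel {y} Ry≈0 v = begin
      last y * det M
        ≈⟨ *-congˡ (det-transpose M) ⟨
      last y * det Mᵀ
        ≈⟨ det-snoc-combination Mᵀ y ⟨
      det (snoc (init Mᵀ) (λ c → sum (λ m → y m * Mᵀ m c)))
        ≈⟨ det-snoc-congʳ (init Mᵀ) (init-last-elim _ at-init at-last) ⟩
      det (snoc (init Mᵀ) (λ c → (v · y) * unitLast c))
        ≈⟨ det-snoc-linear (init Mᵀ) (λ c → sym (trans (+-congˡ (zeroˡ (unitLast c))) (+-identityʳ _))) ⟩
      (v · y) * det (snoc (init Mᵀ) unitLast) + 0# * det (snoc (init Mᵀ) unitLast)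
        ≈⟨ trans (+-congˡ (zeroˡ _)) (+-identityʳ _) ⟩
      (v · y) * det (snoc (init Mᵀ) unitLast)
        ≈⟨ *-congˡ (det-snoc-unitLast (init Mᵀ)) ⟩
      (v · y) * det (λ r c → M (inject₁ c) (inject₁ r))
        ≈⟨ *-congˡ (det-cong (λ r c → reflexive (≡.cong-app (snoc-inject₁ R v c) (inject₁ r)))) ⟩
      (v · y) * det (λ r c → R c (inject₁ r))
        ≈⟨ *-congˡ (det-transpose (λ r c → R r (inject₁ c))) ⟩
      (v · y) * det (λ r c → R r (inject₁ c))
        ≈⟨ *-congˡ (det-snoc-unitLast R) ⟨
      (v · y) * det (snoc R unitLast)
        ∎
      where
      M Mᵀ : Matrix (suc n)
      M = snoc R v
      Mᵀ r c = M c r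
      at-init : ∀ r → sum (λ m → y m * M (inject₁ r) m) ≈ (v · y) * unitLast (inject₁ r)
      at-init r = begin
        sum (λ m → y m * M (inject₁ r) m)  ≈⟨ sum-cong-≋ (λ m → trans (*-comm (y m) (M (inject₁ r) m))
                                                (*-congʳ (reflexive (≡.cong-app (snoc-inject₁ R v r) m)))) ⟩
        R r · y                            ≈⟨ Ry≈0 r ⟩
        0#                                 ≈⟨ trans (*-congˡ (reflexive (snoc-inject₁ (λ (_ : Fin n) → 0#) 1# r))) (zeroʳ _) ⟨
        (v · y) * unitLast (inject₁ r)     ∎
      at-last : sum (λ m → y m * M (fromℕ n) m) ≈ (v · y) * unitLast (fromℕ n)
      at-last = begin
        sum (λ m → y m * M (fromℕ n) m)    ≈⟨ sum-cong-≋ (λ m → trans (*-comm (y m) (M (fromℕ n) m))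
                                                (*-congʳ (reflexive (≡.cong-app (snoc-fromℕ R v) m)))) ⟩
        v · y                              ≈⟨ trans (*-congˡ (reflexive (snoc-fromℕ (λ (_ : Fin n) → 0#) 1#))) (*-identityʳ _) ⟨
        (v · y) * unitLast (fromℕ n)       ∎

  module FixedPoint {n} (W : Fin n → Fin n → Carrier) (b : Fin n → Carrier) (σ : Subset n) where

    open Cramer (a W b σ)

    if-∈ : ∀ {A : Set} {i} {p q : A} → i ∈ σ → (if lookup σ i then p else q) ≡ p
    if-∈ {p = p} {q} i∈σ = ≡.cong (λ t → if t then p else q) ([]=⇒lookup i∈σ)

    if-∉ : ∀ {A : Set} {i} {p q : A} → i ∉ σ → (if lookup σ i then p else q) ≡ q
    if-∉ {i = i} i∉σ with lookup σ i in eq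
    ... | true = ⊥-elim (i∉σ (lookup⇒[]= i σ eq))
    ... | false = ≡.refl

    e·snoc : ∀ i x → e W b i · snoc x 1# ≈ x i
    e·snoc i x = begin
      e W b i · snoc x 1#
        ≈⟨ dot-snoc (e W b i) x 1# ⟩
      sum (λ k → init (e W b i) k * x k) + last (e W b i) * 1#
        ≈⟨ +-cong (sum-cong-≋ (λ k → *-congʳ (reflexive (snoc-inject₁ (δ i) 0# k))))
                  (*-congʳ (reflexive (snoc-fromℕ (δ i) 0#))) ⟩
      sum (λ k → δ i k * x k) + 0# * 1#
        ≈⟨ +-cong (sum-concentrated _ i (λ k k≢i → trans (*-congʳ (reflexive (if-≟-≢ k≢i))) (zeroˡ _))) (zeroˡ 1#) ⟩
      δ i i * x i + 0#
        ≈⟨ trans (+-identityʳ _) (trans (*-congʳ (reflexive (if-≟-≡ i))) (*-identityˡ _)) ⟩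
      x i
        ∎

    h·snoc : ∀ i x → h W b i · snoc x 1# ≈ - x i + lstar W b i x
    h·snoc i x = begin
      h W b i · snoc x 1#
        ≈⟨ dot-snoc (h W b i) x 1# ⟩
      sum (λ k → init (h W b i) k * x k) + last (h W b i) * 1#
        ≈⟨ +-cong (sum-cong-≋ (λ k → trans (*-congʳ (reflexive (snoc-inject₁ row (b i) k)))
                                           (split (does (k ≟ i)) (W i k) (x k))))
                  (trans (*-congʳ (reflexive (snoc-fromℕ row (b i)))) (*-identityʳ (b i))) ⟩
      sum (λ k → diagonal k + off-diagonal k) + b i
        ≈⟨ +-congʳ (∑-distrib-+ diagonal off-diagonal) ⟩
      (sum diagonal + sum off-diagonal) + b i
        ≈⟨ +-congʳ (+-congʳ (sum-concentrated diagonal i (λ k k≢i → reflexive (if-≟-≢ k≢i)))) ⟩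
      (diagonal i + sum off-diagonal) + b i
        ≈⟨ +-assoc _ _ _ ⟩
      diagonal i + (sum off-diagonal + b i)
        ≈⟨ +-cong (reflexive (if-≟-≡ i)) (+-congʳ (reflexive (≡.sym (sumF≡sum off-diagonal)))) ⟩
      - x i + lstar W b i x
        ∎
      where
      row diagonal off-diagonal : Fin n → Carrier
      row k = if does (k ≟ i) then - 1# else W i k
      diagonal k = if does (k ≟ i) then - x k else 0#
      off-diagonal k = if does (k ≟ i) then 0# else W i k * x k
      split : ∀ t w y → (if t then - 1# else w) * y ≈ (if t then - y else 0#) + (if t then 0# else w * y)
      split true w y = trans (-1*x≈-x y) (sym (+-identityʳ _))
      split false w y = sym (+-identityˡ _)

    Kernel : (Fin n → Carrier) → Set
    Kernel x = ∀ r → a W b σ r · snoc x 1# ≈ 0#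

    isXσ⇒kernel : ∀ {x} → IsXσ W b σ x → Kernel x
    isXσ⇒kernel {x} (on-σ , off-σ) r with r ∈? σ
    ... | yes r∈σ = trans (reflexive (≡.cong (_· snoc x 1#) (if-∈ r∈σ))) (trans (h·snoc r x) (on-σ r r∈σ))
    ... | no r∉σ = trans (reflexive (≡.cong (_· snoc x 1#) (if-∉ r∉σ))) (trans (e·snoc r x) (off-σ r r∉σ))

    kernel⇒isXσ : ∀ {x} → Kernel x → IsXσ W b σ x
    kernel⇒isXσ {x} ker = on-σ , off-σ
      where
      on-σ : ∀ i → i ∈ σ → - x i + lstar W b i x ≈ 0#
      on-σ i i∈σ = trans (sym (h·snoc i x)) (trans (reflexive (≡.cong (_· snoc x 1#) (≡.sym (if-∈ i∈σ)))) (ker i))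
      off-σ : ∀ j → j ∉ σ → x j ≈ 0#
      off-σ j j∉σ = trans (sym (e·snoc j x)) (trans (reflexive (≡.cong (_· snoc x 1#) (≡.sym (if-∉ j∉σ)))) (ker j))

    detWith≈·*s∞ : ∀ {x} → IsXσ W b σ x → ∀ v → detWith W b σ v ≈ (v · snoc x 1#) * s∞ W b σ
    detWith≈·*s∞ {x} isXσ v = trans (sym (trans (*-congʳ (reflexive (snoc-fromℕ x 1#))) (*-identityˡ _)))
                                    (det-snoc-kernel {snoc x 1#} (isXσ⇒kernel isXσ) v)

    s≈lstar*s∞ : ∀ {x} → IsXσ W b σ x → ∀ i → s W b σ i ≈ lstar W b i x * s∞ W b σ
    s≈lstar*s∞ {x} isXσ@(on-σ , off-σ) i with i ∈? σ
    ... | yes i∈σ = begin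
      s W b σ i
        ≡⟨ if-∈ i∈σ ⟩
      detWith W b σ (e W b i)
        ≈⟨ detWith≈·*s∞ isXσ (e W b i) ⟩
      (e W b i · snoc x 1#) * s∞ W b σ
        ≈⟨ *-congʳ (e·snoc i x) ⟩
      x i * s∞ W b σ
        ≈⟨ *-congʳ (trans (+-inverseʳ-unique (- x i) _ (on-σ i i∈σ)) (-‿involutive (x i))) ⟨
      lstar W b i x * s∞ W b σ
        ∎
    ... | no i∉σ = begin
      s W b σ i
        ≡⟨ if-∉ i∉σ ⟩
      detWith W b σ (h W b i)
        ≈⟨ detWith≈·*s∞ isXσ (h W b i) ⟩
      (h W b i · snoc x 1#) * s∞ W b σ
        ≈⟨ *-congʳ (h·snoc i x) ⟩
      (- x i + lstar W b i x) * s∞ W b σ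
        ≈⟨ *-congʳ (trans (+-congʳ (trans (-‿cong (off-σ i i∉σ)) -0#≈0#)) (+-identityˡ _)) ⟩
      lstar W b i x * s∞ W b σ
        ∎

    Signs : Set
    Signs = (∀ i → i ∈ σ → 0# < s W b σ i * s∞ W b σ) × (∀ j → j ∉ σ → s W b σ j * s∞ W b σ < 0#)

    L⇔signs : ¬ (s∞ W b σ ≈ 0#) → ∀ {x} → IsXσ W b σ x → L W b σ x ⇔ Signs
    L⇔signs s∞≉0 {x} isXσ = mk⇔
      (λ (pos , neg) → (λ i i∈σ → <-respʳ-≈ (sym (s*s∞ i)) (Equivalence.to (0<a⇔0<a*p 0<s∞²) (pos i i∈σ))) ,
                       (λ j j∉σ → <-respˡ-≈ (sym (s*s∞ j)) (Equivalence.to (a<0⇔a*p<0 0<s∞²) (neg j j∉σ))))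
      (λ (pos , neg) → (λ i i∈σ → Equivalence.from (0<a⇔0<a*p 0<s∞²) (<-respʳ-≈ (s*s∞ i) (pos i i∈σ))) ,
                       (λ j j∉σ → Equivalence.from (a<0⇔a*p<0 0<s∞²) (<-respˡ-≈ (s*s∞ j) (neg j j∉σ))))
      where
      0<s∞² : 0# < s∞ W b σ * s∞ W b σ
      0<s∞² = d≉0⇒0<d*d s∞≉0
      s*s∞ : ∀ i → s W b σ i * s∞ W b σ ≈ lstar W b i x * (s∞ W b σ * s∞ W b σ)
      s*s∞ i = trans (*-congʳ (s≈lstar*s∞ isXσ i)) (*-assoc _ _ _)

    xσ-exists : ¬ (s∞ W b σ ≈ 0#) → ∃ (IsXσ W b σ)
    xσ-exists s∞≉0 = (λ k → detWith W b σ (e W b k) * d) , kernel⇒isXσ (cofactors-in-kernel s∞*d≈1)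
      where
      d : Carrier
      d = proj₁ (inverse (s∞ W b σ) s∞≉0)
      s∞*d≈1 : s∞ W b σ * d ≈ 1#
      s∞*d≈1 = proj₂ (inverse (s∞ W b σ) s∞≉0)

theorem3p1 : (F : OrderedField) → let open OrderedField F in let open TLN F in
    {n : ℕ} (W : Fin n → Fin n → Carrier) (b : Fin n → Carrier) (σ : Subset n) →
    (∀ i → W i i ≈ 0#) →
    ¬ (s∞ W b σ ≈ 0#) →
    SupportsFP W b σ ⇔
      ((∀ i → i ∈ σ → 0# < s W b σ i * s∞ W b σ) ×
       (∀ j → j ∉ σ → s W b σ j * s∞ W b σ < 0#))
theorem3p1 F W b σ _ s∞≉0 = mk⇔
  (λ (x , isXσ , x∈L) → Equivalence.to (L⇔signs s∞≉0 isXσ) x∈L)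
  (λ signs → let (x , isXσ) = xσ-exists s∞≉0 in x , isXσ , Equivalence.from (L⇔signs s∞≉0 isXσ) signs)
  where open FixedPoint F W b σ
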